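{- Let $2\le r\le s$ be integers and let $m$ be such that $m^{1/(r+1)}$ and $m^{r/(r+1)}$ are integers. Let $G$ be the complete bipartite graph with parts $U$ and $V$, where $|U|=m^{1/(r+1)}$ and $|V|=m^{r/(r+1)}$. Then $G$ has $m$ edges and every subgraph of $G$ containing no copy of $K_{r,s}$ has at most $s\,m^{r/(r+1)}$ edges.
   Context: $K_{r,s}$ is the complete bipartite graph with parts of order $r$ and $s$. -}

module Defs where

open import Data.Nat using (ℕ; _+_)
open import Data.Bool using (Bool; true; false; T)
open import Data.Fin using (Fin)
open import Data.Sum using (_⊎_; inj₁; inj₂)
open import Data.Empty using (⊥)
open import Data.List using (List; map; allFin)
open import Data.Nat.ListAction using (sum)
open import Function.Definitions using (Injective)
open import Relation.Binary.PropositionalEquality using (_≡_)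
open import Data.Product using (Σ; _×_)

-- The complete bipartite graph K_{a,b} has vertex set Fin a ⊎ Fin b
-- (part U = Fin a, part V = Fin b) and edges all pairs (u , v).
-- A subgraph H of K_{a,b} is given by its edge set: a subset of U × V,
-- encoded as a Boolean-valued function.
EdgeSet : ℕ → ℕ → Set
EdgeSet a b = Fin a → Fin b → Bool

complete : (a b : ℕ) → EdgeSet a b
complete a b u v = true

Adj : {a b : ℕ} → EdgeSet a b → Fin a ⊎ Fin b → Fin a ⊎ Fin b → Set
Adj E (inj₁ u) (inj₂ v) = T (E u v)
Adj E (inj₂ v) (inj₁ u) = T (E u v)
Adj E (inj₁ _) (inj₁ _) = ⊥
Adj E (inj₂ _) (inj₂ _) = ⊥

bit : Bool → ℕ
bit true  = 1
bit false = 0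

edgeCount : {a b : ℕ} → EdgeSet a b → ℕ
edgeCount {a} {b} E = sum (map (λ u → sum (map (λ v → bit (E u v)) (allFin b))) (allFin a))

ContainsK : (r s : ℕ) {a b : ℕ} → EdgeSet a b → Set
ContainsK r s {a} {b} E =
  Σ (Fin r ⊎ Fin s → Fin a ⊎ Fin b) λ f →
    Injective _≡_ _≡_ f × (∀ (i : Fin r) (j : Fin s) → Adj E (f (inj₁ i)) (f (inj₂ j)))

_⊆E_ : {a b : ℕ} → EdgeSet a b → EdgeSet a b → Set
H ⊆E G = ∀ u v → T (H u v) → T (G u v)

-- Write r = q + 1 and N(v) ⊆ U for the neighbourhood of v ∈ V. Every degree satisfies
-- d ≤ q + C(d, r), and Σ_v C(|N(v)|, r) counts the pairs (v, X) with X an r-subset of N(v).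
-- Counted from the side of X instead: if H has no K_{r,s}, every r-subset of U lies in at most
-- s − 1 neighbourhoods, so the sum is at most (s − 1) C(|U|, r). Since r C(|U|, r) ≤ |U|^r = |V|
-- and r ≤ s, this gives e(H) ≤ q |V| + (s − 1) |V| / r ≤ s |V|.
module Submission where

open import Defs
open import Data.Bool using (Bool; true; false; T; not; _∧_; _∨_)
open import Data.Bool.Properties using (∨-zeroʳ)
open import Data.Fin using (Fin; zero; suc)
import Data.Fin.Properties as Fin
open import Data.List using (map; tabulate)
open import Data.Nat using (ℕ; zero; suc; _+_; _*_; _^_; _≤_; _<_; _>_; _≤?_; _≡ᵇ_; z≤n; s≤s; s≤s⁻¹)
open import Data.Nat.Combinatorics using (_C_; nC1≡n; nCk+nC[k+1]≡[n+1]C[k+1])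
open import Data.Nat.ListAction using () renaming (sum to sumˡ)
open import Data.Nat.Properties
open import Data.Nat.Solver using (module +-*-Solver)
open import Data.Product using (Σ; _×_; _,_)
import Data.Sum as Sum
open import Data.Sum using (inj₁; inj₂)
open import Data.Sum.Properties using (inj₁-injective; inj₂-injective)
open import Data.Unit using (tt)
open import Data.Vec.Functional using (_∷_; head; tail)
open import Function using (_∘_)
open import Function.Definitions using (Injective)
open import Relation.Binary.Definitions using (tri<; tri≈; tri>)
open import Relation.Binary.PropositionalEquality
open import Relation.Nullary using (¬_; yes; no; contradiction)

open import Algebra.Properties.Semiring.Sum +-*-semiring
  using (sum; sum-syntax; sum-cong-≗; ∑-comm; ∑-distrib-+; *-distribʳ-sum)
open +-*-Solver using (solve; _:+_; _:*_; _:=_; con)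

∑-mono-≤ : ∀ {n} {f g : Fin n → ℕ} → (∀ i → f i ≤ g i) → sum f ≤ sum g
∑-mono-≤ {zero}  f≤g = z≤n
∑-mono-≤ {suc n} f≤g = +-mono-≤ (f≤g zero) (∑-mono-≤ (f≤g ∘ suc))

∑-const : ∀ n c → ∑[ i < n ] c ≡ n * c
∑-const zero    c = refl
∑-const (suc n) c = cong (c +_) (∑-const n c)

sumˡ-map-tabulate : ∀ {A : Set} {n} (f : A → ℕ) (g : Fin n → A) →
                    sumˡ (map f (tabulate g)) ≡ ∑[ i < n ] f (g i)
sumˡ-map-tabulate {n = zero}  f g = refl
sumˡ-map-tabulate {n = suc n} f g = cong (f (g zero) +_) (sumˡ-map-tabulate f (g ∘ suc))

edgeCount≡∑∑ : ∀ {a b} (E : EdgeSet a b) → edgeCount E ≡ ∑[ u < a ] ∑[ v < b ] bit (E u v)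
edgeCount≡∑∑ E =
  trans (sumˡ-map-tabulate (λ u → sumˡ (map (λ v → bit (E u v)) (tabulate (λ v → v)))) (λ u → u))
        (sum-cong-≗ (λ u → sumˡ-map-tabulate (λ v → bit (E u v)) (λ v → v)))

edgeCount-complete : ∀ a b → edgeCount (complete a b) ≡ a * b
edgeCount-complete a b = begin
  edgeCount (complete a b)   ≡⟨ edgeCount≡∑∑ (complete a b) ⟩
  ∑[ u < a ] ∑[ v < b ] 1    ≡⟨ sum-cong-≗ {a} (λ _ → trans (∑-const b 1) (*-identityʳ b)) ⟩
  ∑[ u < a ] b               ≡⟨ ∑-const a b ⟩
  a * b                      ∎
  where open ≡-Reasoning

Subset : ℕ → Set
Subset n = Fin n → Bool

∣_∣ : ∀ {n} → Subset n → ℕ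
∣ X ∣ = sum (bit ∘ X)

_⊆ᵇ_ : ∀ {n} → Subset n → Subset n → Bool
_⊆ᵇ_ {zero}  X Y = true
_⊆ᵇ_ {suc n} X Y = (not (head X) ∨ head Y) ∧ (tail X ⊆ᵇ tail Y)

⊆ᵇ-sound : ∀ {n} (X Y : Subset n) → T (X ⊆ᵇ Y) → ∀ i → T (X i) → T (Y i)
⊆ᵇ-sound X Y X⊆Y zero    Xi with X zero | Y zero
... | true | true = Xi
⊆ᵇ-sound X Y X⊆Y (suc i) Xi with not (X zero) ∨ Y zero
... | true = ⊆ᵇ-sound (tail X) (tail Y) X⊆Y i Xi

⊆ᵇ-full : ∀ {n} (X : Subset n) → X ⊆ᵇ (λ _ → true) ≡ true
⊆ᵇ-full {zero}  X = refl
⊆ᵇ-full {suc n} X rewrite ∨-zeroʳ (not (X zero)) = ⊆ᵇ-full (tail X)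

∑ˢ : ∀ {n} → (Subset n → ℕ) → ℕ
∑ˢ {zero}  f = f (λ ())
∑ˢ {suc n} f = ∑ˢ (λ X → f (false ∷ X)) + ∑ˢ (λ X → f (true ∷ X))

∑ˢ-cong : ∀ {n} {f g : Subset n → ℕ} → (∀ X → f X ≡ g X) → ∑ˢ f ≡ ∑ˢ g
∑ˢ-cong {zero}  f≗g = f≗g (λ ())
∑ˢ-cong {suc n} f≗g = cong₂ _+_ (∑ˢ-cong (f≗g ∘ (false ∷_))) (∑ˢ-cong (f≗g ∘ (true ∷_)))

∑ˢ-mono-≤ : ∀ {n} {f g : Subset n → ℕ} → (∀ X → f X ≤ g X) → ∑ˢ f ≤ ∑ˢ g
∑ˢ-mono-≤ {zero}  f≤g = f≤g (λ ())
∑ˢ-mono-≤ {suc n} f≤g = +-mono-≤ (∑ˢ-mono-≤ (f≤g ∘ (false ∷_))) (∑ˢ-mono-≤ (f≤g ∘ (true ∷_)))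

∑ˢ-zero : ∀ n → ∑ˢ {n} (λ _ → 0) ≡ 0
∑ˢ-zero zero    = refl
∑ˢ-zero (suc n) = cong₂ _+_ (∑ˢ-zero n) (∑ˢ-zero n)

∑ˢ-*ˡ : ∀ {n} c (f : Subset n → ℕ) → ∑ˢ (λ X → c * f X) ≡ c * ∑ˢ f
∑ˢ-*ˡ {zero}  c f = refl
∑ˢ-*ˡ {suc n} c f =
  trans (cong₂ _+_ (∑ˢ-*ˡ c (f ∘ (false ∷_))) (∑ˢ-*ˡ c (f ∘ (true ∷_)))) (sym (*-distribˡ-+ c _ _))

∑-∑ˢ-comm : ∀ {m n} (f : Fin m → Subset n → ℕ) →
            ∑[ v < m ] ∑ˢ (f v) ≡ ∑ˢ (λ X → ∑[ v < m ] f v X)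
∑-∑ˢ-comm {n = zero} f = refl
∑-∑ˢ-comm {m} {suc n} f = begin
  sum (λ v → ∑ˢ (f₀ v) + ∑ˢ (f₁ v))               ≡⟨ ∑-distrib-+ (λ v → ∑ˢ (f₀ v)) (λ v → ∑ˢ (f₁ v)) ⟩
  sum (λ v → ∑ˢ (f₀ v)) + sum (λ v → ∑ˢ (f₁ v))   ≡⟨ cong₂ _+_ (∑-∑ˢ-comm f₀) (∑-∑ˢ-comm f₁) ⟩
  ∑ˢ (λ X → sum (λ v → f₀ v X)) + ∑ˢ (λ X → sum (λ v → f₁ v X)) ∎
  where
  open ≡-Reasoning
  f₀ f₁ : Fin m → Subset n → ℕ
  f₀ v X = f v (false ∷ X)
  f₁ v X = f v (true ∷ X)

k≤n⇒nCk>0 : ∀ {n k} → k ≤ n → n C k > 0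
k≤n⇒nCk>0 {n}     {zero}  _         = s≤s z≤n
k≤n⇒nCk>0 {suc n} {suc k} (s≤s k≤n) =
  ≤-trans (k≤n⇒nCk>0 k≤n) (≤-trans (m≤m+n (n C k) (n C suc k)) (≤-reflexive (nCk+nC[k+1]≡[n+1]C[k+1] n k)))

n≤k+nC[k+1] : ∀ n k → n ≤ k + n C suc k
n≤k+nC[k+1] zero    k = z≤n
n≤k+nC[k+1] (suc n) k with k ≤? n
... | no  k≰n = ≤-trans (≰⇒> k≰n) (m≤m+n k _)
... | yes k≤n = begin
  suc n                       ≤⟨ s≤s (n≤k+nC[k+1] n k) ⟩
  suc (k + n C suc k)         ≡⟨ +-suc k _ ⟨
  k + suc (n C suc k)         ≤⟨ +-monoʳ-≤ k (+-monoˡ-≤ (n C suc k) (k≤n⇒nCk>0 k≤n)) ⟩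
  k + (n C k + n C suc k)     ≡⟨ cong (k +_) (nCk+nC[k+1]≡[n+1]C[k+1] n k) ⟩
  k + suc n C suc k           ∎
  where open ≤-Reasoning

nCk≤n^k : ∀ n k → n C k ≤ n ^ k
nCk≤n^k n       zero    = ≤-refl
nCk≤n^k zero    (suc k) = z≤n
nCk≤n^k (suc n) (suc k) = begin
  suc n C suc k             ≡⟨ nCk+nC[k+1]≡[n+1]C[k+1] n k ⟨
  n C k + n C suc k         ≤⟨ +-mono-≤ (nCk≤n^k n k) (nCk≤n^k n (suc k)) ⟩
  n ^ k + n * n ^ k         ≤⟨ *-monoʳ-≤ (suc n) (^-monoˡ-≤ k (n≤1+n n)) ⟩
  suc n * suc n ^ k         ∎
  where open ≤-Reasoning

[k+1]*[n+1]C[k+1]≡[n+1]*nCk : ∀ n k → suc k * (suc n C suc k) ≡ suc n * (n C k)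
[k+1]*[n+1]C[k+1]≡[n+1]*nCk zero    zero    = refl
[k+1]*[n+1]C[k+1]≡[n+1]*nCk zero    (suc k) = *-zeroʳ (suc (suc k))
[k+1]*[n+1]C[k+1]≡[n+1]*nCk (suc n) zero    = begin
  1 * (suc (suc n) C 1)   ≡⟨ *-identityˡ _ ⟩
  suc (suc n) C 1         ≡⟨ nC1≡n (suc (suc n)) ⟩
  suc (suc n)             ≡⟨ *-identityʳ (suc (suc n)) ⟨
  suc (suc n) * 1         ∎
  where open ≡-Reasoning
[k+1]*[n+1]C[k+1]≡[n+1]*nCk (suc n) (suc k) = begin
  suc (suc k) * (suc (suc n) C suc (suc k))
    ≡⟨ cong (suc (suc k) *_) (nCk+nC[k+1]≡[n+1]C[k+1] (suc n) (suc k)) ⟨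
  suc (suc k) * (x + y)
    ≡⟨ solve 3 (λ k x y → (con 2 :+ k) :* (x :+ y) := (con 1 :+ k) :* x :+ x :+ (con 2 :+ k) :* y) refl k x y ⟩
  suc k * x + x + suc (suc k) * y
    ≡⟨ cong₂ (λ u v → u + x + v) ([k+1]*[n+1]C[k+1]≡[n+1]*nCk n k) ([k+1]*[n+1]C[k+1]≡[n+1]*nCk n (suc k)) ⟩
  suc n * (n C k) + x + suc n * (n C suc k)
    ≡⟨ cong (λ z → suc n * (n C k) + z + suc n * (n C suc k)) (nCk+nC[k+1]≡[n+1]C[k+1] n k) ⟨
  suc n * (n C k) + (n C k + n C suc k) + suc n * (n C suc k)
    ≡⟨ solve 3 (λ n u v → (con 1 :+ n) :* u :+ (u :+ v) :+ (con 1 :+ n) :* v := (con 2 :+ n) :* (u :+ v)) refl n (n C k) (n C suc k) ⟩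
  suc (suc n) * (n C k + n C suc k)
    ≡⟨ cong (suc (suc n) *_) (nCk+nC[k+1]≡[n+1]C[k+1] n k) ⟩
  suc (suc n) * (suc n C suc k) ∎
  where
  open ≡-Reasoning
  x y : ℕ
  x = suc n C suc k
  y = suc n C suc (suc k)

k*nCk≤n^k : ∀ n k → k * (n C k) ≤ n ^ k
k*nCk≤n^k n       zero    = z≤n
k*nCk≤n^k zero    (suc k) = ≤-reflexive (*-zeroʳ (suc k))
k*nCk≤n^k (suc n) (suc k) = begin
  suc k * (suc n C suc k) ≡⟨ [k+1]*[n+1]C[k+1]≡[n+1]*nCk n k ⟩
  suc n * (n C k)         ≤⟨ *-monoʳ-≤ (suc n) (≤-trans (nCk≤n^k n k) (^-monoˡ-≤ k (n≤1+n n))) ⟩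
  suc n * suc n ^ k       ∎
  where open ≤-Reasoning

bit-∧-* : ∀ x y c → bit (x ∧ y) * c ≡ bit x * (bit y * c)
bit-∧-* false y c = refl
bit-∧-* true  y c = sym (*-identityˡ (bit y * c))

pascal-bit : ∀ y d k → d C suc k + bit y * (d C k) ≡ (bit y + d) C suc k
pascal-bit false d k = +-identityʳ (d C suc k)
pascal-bit true  d k = begin
  d C suc k + 1 * (d C k) ≡⟨ cong (d C suc k +_) (*-identityˡ (d C k)) ⟩
  d C suc k + d C k       ≡⟨ +-comm (d C suc k) (d C k) ⟩
  d C k + d C suc k       ≡⟨ nCk+nC[k+1]≡[n+1]C[k+1] d k ⟩
  suc d C suc k           ∎
  where open ≡-Reasoning

-- Split on the first point: the subsets X avoiding it contribute C(d, k), those containing it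
-- (possible only when it lies in Y) contribute C(d, k - 1), where d = ∣ tail Y ∣.
count-⊆-size : ∀ {n} (Y : Subset n) k → ∑ˢ (λ X → bit (X ⊆ᵇ Y) * bit (∣ X ∣ ≡ᵇ k)) ≡ ∣ Y ∣ C k
count-⊆-size {zero}  Y zero    = refl
count-⊆-size {zero}  Y (suc k) = refl
count-⊆-size {suc n} Y zero    =
  cong₂ _+_ (count-⊆-size (tail Y) 0) (trans (∑ˢ-cong {n} (λ X → *-zeroʳ (bit (head Y ∧ (X ⊆ᵇ tail Y))))) (∑ˢ-zero n))
count-⊆-size {suc n} Y (suc k) = begin
  ∑ˢ (λ X → bit (X ⊆ᵇ tail Y) * bit (∣ X ∣ ≡ᵇ suc k))
    + ∑ˢ (λ X → bit (head Y ∧ (X ⊆ᵇ tail Y)) * bit (∣ X ∣ ≡ᵇ k))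
    ≡⟨ cong₂ _+_ (count-⊆-size (tail Y) (suc k)) (∑ˢ-cong {n} λ X → bit-∧-* (head Y) (X ⊆ᵇ tail Y) (bit (∣ X ∣ ≡ᵇ k))) ⟩
  ∣ tail Y ∣ C suc k + ∑ˢ (λ X → bit (head Y) * (bit (X ⊆ᵇ tail Y) * bit (∣ X ∣ ≡ᵇ k)))
    ≡⟨ cong (∣ tail Y ∣ C suc k +_) (trans (∑ˢ-*ˡ {n} (bit (head Y)) _) (cong (bit (head Y) *_) (count-⊆-size (tail Y) k))) ⟩
  ∣ tail Y ∣ C suc k + bit (head Y) * (∣ tail Y ∣ C k)
    ≡⟨ pascal-bit (head Y) ∣ tail Y ∣ k ⟩
  ∣ Y ∣ C suc k ∎
  where open ≡-Reasoning

count-size : ∀ n k → ∑ˢ {n} (λ X → bit (∣ X ∣ ≡ᵇ k)) ≡ n C k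
count-size n k = begin
  ∑ˢ {n} (λ X → bit (∣ X ∣ ≡ᵇ k))                ≡⟨ ∑ˢ-cong {n} (λ X → sym (full-weight X)) ⟩
  ∑ˢ (λ X → bit (X ⊆ᵇ full) * bit (∣ X ∣ ≡ᵇ k)) ≡⟨ count-⊆-size full k ⟩
  ∣ full ∣ C k                                     ≡⟨ cong (_C k) (trans (∑-const n 1) (*-identityʳ n)) ⟩
  n C k                                            ∎
  where
  open ≡-Reasoning
  full : Subset n
  full _ = true
  full-weight : ∀ X → bit (X ⊆ᵇ full) * bit (∣ X ∣ ≡ᵇ k) ≡ bit (∣ X ∣ ≡ᵇ k)
  full-weight X rewrite ⊆ᵇ-full X = *-identityˡ (bit (∣ X ∣ ≡ᵇ k))

*-bit-monoˡ-≤ : ∀ {m t} x → (T x → m ≤ t) → m * bit x ≤ t * bit x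
*-bit-monoˡ-≤ {m} {t} false _   = ≤-reflexive (trans (*-zeroʳ m) (sym (*-zeroʳ t)))
*-bit-monoˡ-≤         true  m≤t = *-monoˡ-≤ 1 (m≤t tt)

∑-C-≤ : ∀ {a b} (N : Fin b → Subset a) k t →
        (∀ X → ∣ X ∣ ≡ k → ∑[ v < b ] bit (X ⊆ᵇ N v) ≤ t) →
        ∑[ v < b ] (∣ N v ∣ C k) ≤ t * (a C k)
∑-C-≤ {a} {b} N k t codeg≤t = begin
  ∑[ v < b ] (∣ N v ∣ C k)
    ≡⟨ sum-cong-≗ (λ v → sym (count-⊆-size (N v) k)) ⟩
  ∑[ v < b ] ∑ˢ (λ X → bit (X ⊆ᵇ N v) * w X)
    ≡⟨ ∑-∑ˢ-comm (λ v X → bit (X ⊆ᵇ N v) * w X) ⟩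
  ∑ˢ (λ X → ∑[ v < b ] (bit (X ⊆ᵇ N v) * w X))
    ≡⟨ ∑ˢ-cong (λ X → sym (*-distribʳ-sum (w X) (λ v → bit (X ⊆ᵇ N v)))) ⟩
  ∑ˢ (λ X → ∑[ v < b ] bit (X ⊆ᵇ N v) * w X)
    ≤⟨ ∑ˢ-mono-≤ (λ X → *-bit-monoˡ-≤ (∣ X ∣ ≡ᵇ k) (codeg≤t X ∘ ≡ᵇ⇒≡ ∣ X ∣ k)) ⟩
  ∑ˢ (λ X → t * w X)
    ≡⟨ ∑ˢ-*ˡ t w ⟩
  t * ∑ˢ w
    ≡⟨ cong (t *_) (count-size a k) ⟩
  t * (a C k) ∎
  where
  open ≤-Reasoning
  w : Subset a → ℕ
  w X = bit (∣ X ∣ ≡ᵇ k)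

zero∷suc∘-injective : ∀ {k n} {g : Fin k → Fin n} → Injective _≡_ _≡_ g → Injective _≡_ _≡_ (zero ∷ suc ∘ g)
zero∷suc∘-injective g-inj {zero}  {zero}  _  = refl
zero∷suc∘-injective g-inj {suc i} {suc j} eq = cong suc (g-inj (Fin.suc-injective eq))

pick : ∀ {n} (X : Subset n) k → k ≤ ∣ X ∣ →
       Σ (Fin k → Fin n) λ g → Injective _≡_ _≡_ g × (∀ i → T (X (g i)))
pick X zero _ = (λ ()) , (λ { {()} }) , (λ ())
pick {suc n} X (suc k) k<∣X∣ with X zero in X₀
... | true with pick (tail X) k (s≤s⁻¹ k<∣X∣)
...   | g , g-inj , g⊆X =
  zero ∷ suc ∘ g , zero∷suc∘-injective g-inj , λ { zero → subst T (sym X₀) tt ; (suc i) → g⊆X i }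
pick {suc n} X (suc k) k<∣X∣ | false with pick (tail X) (suc k) k<∣X∣
...   | g , g-inj , g⊆X = suc ∘ g , g-inj ∘ Fin.suc-injective , g⊆X

⊎-map-injective : ∀ {A B C D : Set} {f : A → C} {g : B → D} →
                  Injective _≡_ _≡_ f → Injective _≡_ _≡_ g → Injective _≡_ _≡_ (Sum.map f g)
⊎-map-injective f-inj g-inj {inj₁ x} {inj₁ y} eq = cong inj₁ (f-inj (inj₁-injective eq))
⊎-map-injective f-inj g-inj {inj₂ x} {inj₂ y} eq = cong inj₂ (g-inj (inj₂-injective eq))

nbhd : ∀ {a b} → EdgeSet a b → Fin b → Subset a
nbhd H v u = H u v

codegree : ∀ {a b} → EdgeSet a b → Subset a → ℕ
codegree {b = b} H X = ∑[ v < b ] bit (X ⊆ᵇ nbhd H v)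

K-copy : ∀ {r s a b} (H : EdgeSet a b) (X : Subset a) → r ≤ ∣ X ∣ → s ≤ codegree H X → ContainsK r s H
K-copy {r} {s} H X r≤∣X∣ s≤codeg with pick X r r≤∣X∣ | pick (λ v → X ⊆ᵇ nbhd H v) s s≤codeg
... | g , g-inj , g⊆X | h , h-inj , X⊆Nh =
  Sum.map g h , ⊎-map-injective g-inj h-inj , λ i j → ⊆ᵇ-sound X (nbhd H (h j)) (X⊆Nh j) (g i) (g⊆X i)

codegree<s : ∀ {r s a b} (H : EdgeSet a b) → ¬ ContainsK r s H → ∀ X → ∣ X ∣ ≡ r → codegree H X < s
codegree<s H K-free X ∣X∣≡r = ≰⇒> (K-free ∘ K-copy H X (≤-reflexive (sym ∣X∣≡r)))

edgeCount≡∑deg : ∀ {a b} (H : EdgeSet a b) → edgeCount H ≡ ∑[ v < b ] ∣ nbhd H v ∣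
edgeCount≡∑deg H = trans (edgeCount≡∑∑ H) (∑-comm (λ u v → bit (H u v)))

edgeCount≤ : ∀ {a b} (H : EdgeSet a b) q t → (∀ X → ∣ X ∣ ≡ suc q → codegree H X ≤ t) →
             edgeCount H ≤ b * q + t * (a C suc q)
edgeCount≤ {a} {b} H q t codeg≤t = begin
  edgeCount H                                        ≡⟨ edgeCount≡∑deg H ⟩
  ∑[ v < b ] ∣ nbhd H v ∣                            ≤⟨ ∑-mono-≤ (λ v → n≤k+nC[k+1] ∣ nbhd H v ∣ q) ⟩
  ∑[ v < b ] (q + ∣ nbhd H v ∣ C suc q)              ≡⟨ ∑-distrib-+ (λ _ → q) (λ v → ∣ nbhd H v ∣ C suc q) ⟩
  ∑[ v < b ] q + ∑[ v < b ] (∣ nbhd H v ∣ C suc q)   ≤⟨ +-mono-≤ (≤-reflexive (∑-const b q)) (∑-C-≤ (nbhd H) (suc q) t codeg≤t) ⟩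
  b * q + t * (a C suc q)                            ∎
  where open ≤-Reasoning

A*q+t*c≤[1+t]*A : ∀ {q t} A c → q ≤ t → suc q * c ≤ A → A * q + t * c ≤ suc t * A
A*q+t*c≤[1+t]*A {q} A c q≤t [1+q]c≤A with m≤n⇒∃[o]m+o≡n q≤t
... | e , refl = begin
  A * q + (q + e) * c       ≡⟨ cong (A * q +_) (*-distribʳ-+ c q e) ⟩
  A * q + (q * c + e * c)   ≤⟨ +-monoʳ-≤ (A * q) (+-mono-≤ qc≤A (*-monoʳ-≤ e c≤A)) ⟩
  A * q + (A + e * A)       ≡⟨ solve 3 (λ q e A → A :* q :+ (A :+ e :* A) := (con 1 :+ q :+ e) :* A) refl q e A ⟩
  suc (q + e) * A           ∎
  where
  open ≤-Reasoning
  c≤A : c ≤ A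
  c≤A = ≤-trans (m≤m+n c (q * c)) [1+q]c≤A
  qc≤A : q * c ≤ A
  qc≤A = ≤-trans (m≤n+m (q * c) c) [1+q]c≤A

^-cancelʳ-≡ : ∀ n {x y} → x ^ suc n ≡ y ^ suc n → x ≡ y
^-cancelʳ-≡ n {x} {y} eq with <-cmp x y
... | tri< x<y _ _ = contradiction eq (<⇒≢ (^-monoˡ-< (suc n) x<y))
... | tri≈ _ x≡y _ = x≡y
... | tri> _ _ x>y = contradiction eq (≢-sym (<⇒≢ (^-monoˡ-< (suc n) x>y)))

[x^[1+n]]^n≡[x^n]^[1+n] : ∀ x n → (x ^ suc n) ^ n ≡ (x ^ n) ^ suc n
[x^[1+n]]^n≡[x^n]^[1+n] x n = begin
  (x ^ suc n) ^ n  ≡⟨ ^-*-assoc x (suc n) n ⟩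
  x ^ (suc n * n)  ≡⟨ cong (x ^_) (*-comm (suc n) n) ⟩
  x ^ (n * suc n)  ≡⟨ ^-*-assoc x n (suc n) ⟨
  (x ^ n) ^ suc n  ∎
  where open ≡-Reasoning

theorem3p3 : (r s m a b : ℕ) → 2 ≤ r → r ≤ s →
    a ^ suc r ≡ m → b ^ suc r ≡ m ^ r →
    (edgeCount (complete a b) ≡ m)
    × (∀ (H : EdgeSet a b) → H ⊆E complete a b → ¬ ContainsK r s H →
         edgeCount H ≤ s * b)
theorem3p3 r@(suc q) s@(suc t) m a b (s≤s _) (s≤s q≤t) aʳ⁺¹≡m bʳ⁺¹≡mʳ = edges-complete , edges-K-free
  where
  b≡aʳ : b ≡ a ^ r
  b≡aʳ = ^-cancelʳ-≡ r (trans bʳ⁺¹≡mʳ (trans (cong (_^ r) (sym aʳ⁺¹≡m)) ([x^[1+n]]^n≡[x^n]^[1+n] a r)))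

  edges-complete : edgeCount (complete a b) ≡ m
  edges-complete = trans (edgeCount-complete a b) (trans (cong (a *_) b≡aʳ) aʳ⁺¹≡m)

  edges-K-free : ∀ H → H ⊆E complete a b → ¬ ContainsK r s H → edgeCount H ≤ s * b
  edges-K-free H _ K-free = begin
    edgeCount H          ≤⟨ edgeCount≤ H q t (λ X ∣X∣≡r → s≤s⁻¹ (codegree<s H K-free X ∣X∣≡r)) ⟩
    b * q + t * (a C r)  ≤⟨ A*q+t*c≤[1+t]*A b (a C r) q≤t (subst (r * (a C r) ≤_) (sym b≡aʳ) (k*nCk≤n^k a r)) ⟩
    s * b                ∎
    where open ≤-Reasoning
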